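{- Let $(P,\le,{}',0,1)$ be a Boolean poset, $a,b\in P$ and $\Theta$ a congruence on $(P,\le,{}',0,1)$. Then: (i) if $(a,b)\in\Theta$ then $\operatorname{Min}U(a,b')\cap[1]\Theta\ne\emptyset$; (ii) if $a\le b$ and $LU(a,b')\cap[1]\Theta\ne\emptyset$ then $(a,b)\in\Theta$; (iii) if $a\le b$ and the supremum $a\vee b'$ exists, then $(a,b)\in\Theta$ if and only if $a\vee b'\in[1]\Theta$.
   Context: For a poset $(P,\le)$ and $A\subseteq P$ let $L(A)=\{x\mid x\le y\ \forall y\in A\}$, $U(A)=\{x\mid y\le x\ \forall y\in A\}$; write $L(x,y)=L(\{x,y\})$, $U(x,y)$, $L(A,z)=L(A\cup\{z\})$, $LU(x,y)=L(U(x,y))$, etc.; $\operatorname{Max}A$, $\operatorname{Min}A$ are the sets of maximal, minimal elements. A poset is distributive if $L(U(x,y),z)=LU(L(x,z),L(y,z))$ for all $x,y,z$. A complementation on a bounded poset $(P,\le,0,1)$ is a unary operation $'$ with $U(x,x')=\{1\}$ and $L(x,x')=\{0\}$; a Boolean poset is a distributive bounded poset with a complementation. A binary relation $R$ is compatible with a map $Q\colon P^2\to2^P$ if whenever $(a_1,b_1),(a_2,b_2)\in R$ there exist $a\in Q(a_1,a_2)$, $b\in Q(b_1,b_2)$ with $(a,b)\in R$. A congruence on a Boolean poset is an equivalence relation $\Theta$ compatible with $(x,y)\mapsto\operatorname{Max}L(x,y)$, $(x,y)\mapsto\operatorname{Min}U(x,y)$ and $'$ (i.e. $(a,b)\in\Theta\Rightarrow(a',b')\in\Theta$);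 $[1]\Theta$ is the class of $1$. -}

module Defs where

open import Level using (Level; _⊔_; suc)
open import Data.Product using (Σ; ∃; _×_; _,_)
open import Data.Sum using (_⊎_)
open import Relation.Binary.Core using (Rel)
open import Relation.Binary.Structures using (IsPartialOrder; IsEquivalence)
open import Relation.Binary.PropositionalEquality using (_≡_)
open import Relation.Unary using (Pred; _∈_; _⊆_)

_≐_ : ∀ {a ℓ m} {A : Set a} → Pred A ℓ → Pred A m → Set (a ⊔ ℓ ⊔ m)
X ≐ Y = (X ⊆ Y) × (Y ⊆ X)

module PosetNotions {c ℓ : Level} {P : Set c} (_≤_ : Rel P ℓ) where

  L : ∀ {k} → Pred P k → Pred P (c ⊔ ℓ ⊔ k)
  L A x = ∀ y → A y → x ≤ y

  U : ∀ {k} → Pred P k → Pred P (c ⊔ ℓ ⊔ k)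
  U A x = ∀ y → A y → y ≤ x

  pair : P → P → Pred P c
  pair x y z = (z ≡ x) ⊎ (z ≡ y)

  sing : P → Pred P c
  sing x z = z ≡ x

  _∪_ : ∀ {k m} → Pred P k → Pred P m → Pred P (k ⊔ m)
  (A ∪ B) z = A z ⊎ B z

  L₂ : P → P → Pred P (c ⊔ ℓ)
  L₂ x y = L (pair x y)

  U₂ : P → P → Pred P (c ⊔ ℓ)
  U₂ x y = U (pair x y)

  Max : ∀ {k} → Pred P k → Pred P (c ⊔ ℓ ⊔ k)
  Max A x = A x × (∀ y → A y → x ≤ y → y ≡ x)

  Min : ∀ {k} → Pred P k → Pred P (c ⊔ ℓ ⊔ k)
  Min A x = A x × (∀ y → A y → y ≤ x → y ≡ x)

  IsSup : P → P → P → Set (c ⊔ ℓ)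
  IsSup x y s = U₂ x y s × (∀ t → U₂ x y t → s ≤ t)

  Distributive : Set (c ⊔ ℓ)
  Distributive = ∀ x y z →
    L (U₂ x y ∪ sing z) ≐ L (U (L₂ x z ∪ L₂ y z))

record BooleanPoset (c ℓ : Level) : Set (suc (c ⊔ ℓ)) where
  field
    Carrier : Set c
    _≤_     : Rel Carrier ℓ
    isPartialOrder : IsPartialOrder _≡_ _≤_
    𝟘 𝟙 : Carrier
    𝟘-min : ∀ x → 𝟘 ≤ x
    𝟙-max : ∀ x → x ≤ 𝟙
    _′ : Carrier → Carrier
  open PosetNotions _≤_ public
  field
    distributive : Distributive
    compl-U : ∀ x → U₂ x (x ′) ≐ sing 𝟙
    compl-L : ∀ x → L₂ x (x ′) ≐ sing 𝟘

module _ {c ℓ : Level} (B : BooleanPoset c ℓ) where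
  open BooleanPoset B

  Compatible : ∀ {t k} → Rel Carrier t → (Carrier → Carrier → Pred Carrier k) → Set (c ⊔ t ⊔ k)
  Compatible R Q = ∀ {a₁ b₁ a₂ b₂} → R a₁ b₁ → R a₂ b₂ →
    ∃ λ a → ∃ λ b → Q a₁ a₂ a × Q b₁ b₂ b × R a b

  record IsCongruence {t} (Θ : Rel Carrier t) : Set (c ⊔ ℓ ⊔ t) where
    field
      isEquivalence : IsEquivalence Θ
      compat-MaxL   : Compatible Θ (λ x y → Max (L₂ x y))
      compat-MinU   : Compatible Θ (λ x y → Min (U₂ x y))
      compat-′      : ∀ {a b} → Θ a b → Θ (a ′) (b ′)

  class𝟙 : ∀ {t} → Rel Carrier t → Pred Carrier t
  class𝟙 Θ x = Θ x 𝟙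

{-# OPTIONS --safe #-}
module Submission where

-- Part (i): compatibility with joins, applied to a Θ b and b′ Θ b′, yields x ∈ Min U(a,b′)
-- congruent to some element of Min U(b,b′) = {1}.  Part (ii): compatibility with meets,
-- applied to x Θ 1 and b Θ b, yields u ∈ Max L(x,b) congruent to the only element b of
-- Max L(1,b).  As u ∈ L(U(a,b′),b) = LU(L(a,b),L(b′,b)) and L(b′,b) = {0}, we get u ≤ a;
-- so u ≤ a ≤ b with u Θ b, and congruence classes are convex.  Part (iii) follows since a
-- supremum is the unique minimal upper bound and lies in LU(a,b′).

open import Defs
open import Data.Product using (∃; _×_; _,_; proj₁)
open import Data.Sum using (inj₁; inj₂)
open import Relation.Binary.Core using (Rel)
open import Relation.Binary.Definitions using (Reflexive)
open import Relation.Binary.Structures using (IsPartialOrder; IsEquivalence)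
open import Relation.Binary.PropositionalEquality using (_≡_; refl; sym; subst)
open import Function.Bundles using (_⇔_; mk⇔)

module ReflexiveRelationProperties {c ℓ} {P : Set c} {_≤_ : Rel P ℓ} (≤-refl : Reflexive _≤_) where
  open PosetNotions _≤_

  upper-pair : ∀ {x y z} → x ≤ z → y ≤ z → U₂ x y z
  upper-pair x≤z y≤z _ (inj₁ refl) = x≤z
  upper-pair x≤z y≤z _ (inj₂ refl) = y≤z

  lower-pair : ∀ {x y z} → z ≤ x → z ≤ y → L₂ x y z
  lower-pair z≤x z≤y _ (inj₁ refl) = z≤x
  lower-pair z≤x z≤y _ (inj₂ refl) = z≤y

  L₂-comm : ∀ {x y z} → L₂ x y z → L₂ y x z
  L₂-comm zL _ (inj₁ refl) = zL _ (inj₂ refl)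
  L₂-comm zL _ (inj₂ refl) = zL _ (inj₁ refl)

  Min-U₂-≤ : ∀ {x y z} → x ≤ y → Min (U₂ x y) z → z ≡ y
  Min-U₂-≤ x≤y (zU , zmin) = sym (zmin _ (upper-pair x≤y ≤-refl) (zU _ (inj₂ refl)))

  Min-U₂-≥ : ∀ {x y z} → y ≤ x → Min (U₂ x y) z → z ≡ x
  Min-U₂-≥ y≤x (zU , zmin) = sym (zmin _ (upper-pair ≤-refl y≤x) (zU _ (inj₁ refl)))

  Max-L₂-≥ : ∀ {x y z} → y ≤ x → Max (L₂ x y) z → z ≡ y
  Max-L₂-≥ y≤x (zL , zmax) = sym (zmax _ (lower-pair y≤x ≤-refl) (zL _ (inj₂ refl)))

  Sup-Min-U₂ : ∀ {x y s z} → IsSup x y s → Min (U₂ x y) z → z ≡ s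
  Sup-Min-U₂ (sU , sleast) (zU , zmin) = sym (zmin _ sU (sleast _ zU))

module BooleanPosetProperties {c ℓ} (B : BooleanPoset c ℓ) where
  open BooleanPoset B
  open IsPartialOrder isPartialOrder using () renaming (refl to ≤-refl)
  open ReflexiveRelationProperties {_≤_ = _≤_} ≤-refl public

  Min-U₂-compl≡𝟙 : ∀ {x z} → Min (U₂ x (x ′)) z → z ≡ 𝟙
  Min-U₂-compl≡𝟙 (zU , _) = proj₁ (compl-U _) zU

  L₂-compl≡𝟘 : ∀ {x z} → L₂ (x ′) x z → z ≡ 𝟘
  L₂-compl≡𝟘 zL = proj₁ (compl-L _) (L₂-comm zL)

  LU-compl-≤⇒≤ : ∀ {a b u} → L (U₂ a (b ′)) u → u ≤ b → u ≤ a
  LU-compl-≤⇒≤ {a} {b} {u} uLU u≤b = proj₁ (distributive a (b ′) b) lower a a-upper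
    where
    lower : L (U₂ a (b ′) ∪ sing b) u
    lower z (inj₁ zU)   = uLU z zU
    lower _ (inj₂ refl) = u≤b

    a-upper : U (L₂ a b ∪ L₂ (b ′) b) a
    a-upper _ (inj₁ yL) = yL a (inj₁ refl)
    a-upper _ (inj₂ yL) = subst (_≤ a) (sym (L₂-compl≡𝟘 yL)) (𝟘-min a)

module CongruenceProperties {c ℓ t} (B : BooleanPoset c ℓ) {Θ : Rel (BooleanPoset.Carrier B) t}
                            (isCongruence : IsCongruence B Θ) where
  open BooleanPoset B
  open BooleanPosetProperties B
  open IsCongruence isCongruence
  open IsEquivalence isEquivalence using () renaming (refl to Θ-refl)
  open IsPartialOrder isPartialOrder using () renaming (trans to ≤-trans)

  Θ-convex : ∀ {u a b} → u ≤ a → a ≤ b → Θ u b → Θ a b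
  Θ-convex {a = a} {b} u≤a a≤b uΘb with compat-MinU uΘb (Θ-refl {a})
  ... | w , z , wMin , zMin , wΘz =
    subst (λ q → Θ q b) (Min-U₂-≤ u≤a wMin) (subst (Θ w) (Min-U₂-≥ a≤b zMin) wΘz)

  Min-U₂-compl-class𝟙 : ∀ {a b} → Θ a b → ∃ λ x → Min (U₂ a (b ′)) x × class𝟙 B Θ x
  Min-U₂-compl-class𝟙 {b = b} aΘb with compat-MinU aΘb (Θ-refl {b ′})
  ... | x , y , xMin , yMin , xΘy = x , xMin , subst (Θ x) (Min-U₂-compl≡𝟙 yMin) xΘy

  class𝟙-∧ : ∀ {x b} → class𝟙 B Θ x → ∃ λ u → Max (L₂ x b) u × Θ u b
  class𝟙-∧ {b = b} xΘ𝟙 with compat-MaxL xΘ𝟙 (Θ-refl {b})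
  ... | u , v , uMax , vMax , uΘv = u , uMax , subst (Θ u) (Max-L₂-≥ (𝟙-max b) vMax) uΘv

  LU-compl-class𝟙⇒Θ : ∀ {a b} → a ≤ b → (∃ λ x → L (U₂ a (b ′)) x × class𝟙 B Θ x) → Θ a b
  LU-compl-class𝟙⇒Θ {a} {b} a≤b (x , xLU , xΘ𝟙) with class𝟙-∧ {b = b} xΘ𝟙
  ... | u , (uL , _) , uΘb = Θ-convex u≤a a≤b uΘb
    where
    u≤a : u ≤ a
    u≤a = LU-compl-≤⇒≤ (λ z zU → ≤-trans (uL x (inj₁ refl)) (xLU z zU)) (uL b (inj₂ refl))

  Θ⇔Sup-class𝟙 : ∀ {a b s} → a ≤ b → IsSup a (b ′) s → (Θ a b ⇔ class𝟙 B Θ s)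
  Θ⇔Sup-class𝟙 {a} {b} {s} a≤b sSup@(_ , sLeast) = mk⇔ to from
    where
    to : Θ a b → class𝟙 B Θ s
    to aΘb with Min-U₂-compl-class𝟙 aΘb
    ... | x , xMin , xΘ𝟙 = subst (class𝟙 B Θ) (Sup-Min-U₂ sSup xMin) xΘ𝟙

    from : class𝟙 B Θ s → Θ a b
    from sΘ𝟙 = LU-compl-class𝟙⇒Θ a≤b (s , sLeast , sΘ𝟙)

theorem5p7 : ∀ {c ℓ t} (B : BooleanPoset c ℓ) → let open BooleanPoset B in
    (Θ : Rel Carrier t) → IsCongruence B Θ → (a b : Carrier) →
      (Θ a b → ∃ λ x → Min (U₂ a (b ′)) x × class𝟙 B Θ x)
      × (a ≤ b → (∃ λ x → L (U₂ a (b ′)) x × class𝟙 B Θ x) → Θ a b)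
      × (a ≤ b → ∀ s → IsSup a (b ′) s → (Θ a b ⇔ class𝟙 B Θ s))
theorem5p7 B Θ isCongruence a b =
  Min-U₂-compl-class𝟙 , LU-compl-class𝟙⇒Θ , λ a≤b s → Θ⇔Sup-class𝟙 a≤b
  where open CongruenceProperties B isCongruence
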